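{- Let $g$ and $\ell$ be positive integers, and for every integer $h$ let $n'_{h,\ell}$ denote the number of gapsets of genus $h$ all of whose Kunz coordinates lie in $[\ell, 2\ell+1] \cap \mathbb{Z}$. Then $$\sum_{i=\ell}^{2\ell} n'_{g-i,\ell} \;\leq\; n'_{g,\ell} \;\leq\; \sum_{i=\ell}^{2\ell+1} n'_{g-i,\ell}.$$
   Context: $\mathbb{N}$ denotes the positive integers and $\mathbb{N}_0 = \mathbb{N} \cup \{0\}$. A gapset is a finite set $G \subset \mathbb{N}$ such that whenever $z \in G$ and $z = x + y$ with $x, y \in \mathbb{N}$, then $x \in G$ or $y \in G$. Its genus is $\#G$ and its multiplicity is $m = \min\{s \in \mathbb{N} : s \notin G\}$. For $i \in [1, m-1]\cap\mathbb{Z}$, let $w_i = \min\{s \in \mathbb{N}_0 \setminus G : s \equiv i \pmod m\}$; the Kunz coordinates of $G$ are the tuple $(k_1, \ldots, k_{m-1})$ with $k_i = (w_i - i)/m$ (equivalently $k_i = \#\{z \in G : z \equiv i \pmod m\}$). The empty gapset has multiplicity $1$ and empty tuple of Kunz coordinates, so it vacuously satisfies the coordinate condition and $n'_{0,\ell} = 1$; for $h < 0$, $n'_{h,\ell} = 0$. For $\ell = 1$ the gapsets counted are exactly those of depth at most $3$. -}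

module Defs where

open import Data.Nat using (ℕ; zero; suc; _+_; _*_; _≤_; _<_)
open import Data.Nat.DivMod using (_%_)
open import Data.Nat.Properties using (_≟_)
open import Data.Integer using (ℤ; +_)
open import Data.List using (List; length; filter; map; upTo)
open import Data.Nat.ListAction using (sum)
open import Data.List.Membership.Propositional using (_∈_; _∉_)
open import Data.List.Relation.Unary.All using (All)
open import Data.List.Relation.Unary.Linked using (Linked)
open import Data.List.Relation.Unary.Unique.Propositional using (Unique)
open import Data.Product using (_×_; Σ)
open import Data.Sum using (_⊎_)
open import Function.Bundles using (_⇔_)
open import Relation.Binary.PropositionalEquality using (_≡_)

-- A finite subset of ℕ (= positive integers here) is represented canonically
-- by the strictly increasing list of its elements, all of which are ≥ 1.
IsFinPosSet : List ℕ → Set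
IsFinPosSet G = Linked _<_ G × All (λ z → 1 ≤ z) G

IsGapset : List ℕ → Set
IsGapset G = IsFinPosSet G ×
  (∀ z x y → z ∈ G → 1 ≤ x → 1 ≤ y → z ≡ x + y → (x ∈ G) ⊎ (y ∈ G))

genus : List ℕ → ℕ
genus G = length G

IsMultiplicity : List ℕ → ℕ → Set
IsMultiplicity G m = 1 ≤ m × m ∉ G × (∀ s → 1 ≤ s → s < m → s ∈ G)

kunz : List ℕ → (m' : ℕ) → ℕ → ℕ
kunz G m' i = length (filter (λ z → z % suc m' ≟ i) G)

KunzInRange : ℕ → List ℕ → Set
KunzInRange ℓ G = ∀ m' → IsMultiplicity G (suc m') →
  ∀ i → 1 ≤ i → i < suc m' → ℓ ≤ kunz G m' i × kunz G m' i ≤ 2 * ℓ + 1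

Counted : ℕ → ℤ → List ℕ → Set
Counted ℓ h G = IsGapset G × (+ genus G ≡ h) × KunzInRange ℓ G

IsCount : ℕ → ℤ → ℕ → Set
IsCount ℓ h N = Σ (List (List ℕ)) λ L →
  Unique L × (∀ G → (G ∈ L) ⇔ Counted ℓ h G) × length L ≡ N

sumFrom : ℕ → ℕ → (ℕ → ℕ) → ℕ
sumFrom a k f = sum (map (λ j → f (a + j)) (upTo k))

{-# OPTIONS --safe #-}
module Submission where

-- A gapset of multiplicity m is determined by its Kunz coordinates (k_1, …, k_{m-1}), and a tuple of
-- positive integers comes from a gapset iff k_{a+b} ≤ k_a + k_b for a + b < m and
-- k_{a+b-m} ≤ k_a + k_b + 1 for a + b > m; the genus is the sum of the coordinates. Classify the
-- counted gapsets of genus g by their last coordinate c = k_{m-1} ∈ [ℓ, 2ℓ+1]. Dropping it gives a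
-- counted gapset of genus g - c. Conversely, appending c ≤ 2ℓ always gives a counted gapset: with all
-- coordinates in [ℓ, 2ℓ+1] the second family of inequalities holds automatically, and the new
-- inequalities c ≤ k_a + k_b hold because k_a + k_b ≥ 2ℓ. So the class of c has exactly n'_{g-c}
-- elements when c ≤ 2ℓ and at most n'_{g-c} when c = 2ℓ + 1.

open import Defs
open import Data.Nat using (ℕ; _+_; _*_; _≤_; NonZero; zero; suc; pred; _∸_; _<_; z≤n; s≤s; s≤s⁻¹; _<?_)
open import Data.Integer using (ℤ; +_; _-_)
open import Data.Product using (_×_; _,_; proj₁; proj₂; Σ)
open import Data.Nat.Properties
open import Data.Nat.DivMod using (_%_; _/_; m≡m%n+[m/n]*n; [m+kn]%n≡m%n; m<n⇒m%n≡m; m%n<n; n%n≡0)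
open import Data.Nat.ListAction using (sum)
open import Data.Nat.ListAction.Properties using (sum-++)
open import Data.Nat.Tactic.RingSolver using (solve-∀)
import Data.Integer as ℤ
import Data.Integer.Properties as ℤ
open import Algebra.Properties.AbelianGroup ℤ.+-0-abelianGroup using (//-rightDividesˡ; //-rightDividesʳ)
open import Data.List using (List; []; _∷_; [_]; _++_; length; filter; map; upTo)
open import Data.List.Properties
  using (length-++; length-map; length-upTo; map-++; map-∘; upTo-∷ʳ; filter-≐; filter-accept; filter-reject; filter-none)
open import Data.List.Membership.Propositional using (_∈_; _∉_)
open import Data.List.Membership.Propositional.Properties
  using (∈-∃++; ∈-++⁻; ∈-++⁺ˡ; ∈-++⁺ʳ; ∈-filter⁺; ∈-filter⁻; ∈-map⁺; ∈-map⁻; ∈-upTo⁺; ∈-upTo⁻)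
open import Data.List.Membership.DecPropositional _≟_ using (_∈?_)
open import Data.List.Relation.Unary.Any using (here; there)
import Data.List.Relation.Unary.All as All
open import Data.List.Relation.Unary.AllPairs as AllPairs using (AllPairs; []; _∷_)
open import Data.List.Relation.Unary.Linked using (Linked)
import Data.List.Relation.Unary.Linked.Properties as Linked
open import Data.List.Relation.Unary.Unique.Propositional using (Unique)
import Data.List.Relation.Unary.Unique.Propositional.Properties as Unique
open import Data.Sum using (_⊎_; inj₁; inj₂; [_,_]′)
open import Data.Empty using (⊥-elim)
open import Function using (id; _∘_; case_of_; Equivalence)
open import Relation.Binary.Definitions using (tri<; tri≈; tri>)
open import Relation.Binary.PropositionalEquality
  using (_≡_; refl; sym; trans; cong; cong₂; subst; subst₂; module ≡-Reasoning)
open import Relation.Nullary using (yes; no)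
open import Relation.Nullary.Decidable using (_×-dec_)
open import Relation.Unary using (Decidable)

module _ {A B : Set} where

  length-≤-by-retraction : ∀ (f : A → B) (r : B → A) {xs ys} → Unique xs →
    (∀ {x} → x ∈ xs → f x ∈ ys) → (∀ {x} → x ∈ xs → r (f x) ≡ x) →
    length xs ≤ length ys
  length-≤-by-retraction f r {[]} _ _ _ = z≤n
  length-≤-by-retraction f r {x ∷ xs} (x∉xs ∷ !xs) into retract
    with us , vs , refl ← ∈-∃++ (into (here refl)) = begin
      suc (length xs)            ≤⟨ s≤s (length-≤-by-retraction f r !xs into′ (retract ∘ there)) ⟩
      suc (length (us ++ vs))    ≡⟨ cong suc (length-++ us) ⟩
      suc (length us + length vs) ≡⟨ +-suc (length us) (length vs) ⟨
      length us + length (f x ∷ vs) ≡⟨ length-++ us ⟨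
      length (us ++ f x ∷ vs)    ∎
    where
    open ≤-Reasoning
    into′ : ∀ {z} → z ∈ xs → f z ∈ us ++ vs
    into′ z∈ with ∈-++⁻ us (into (there z∈))
    ... | inj₁ p = ∈-++⁺ˡ p
    ... | inj₂ (there p) = ∈-++⁺ʳ us p
    ... | inj₂ (here fz≡fx) = ⊥-elim (All.lookup x∉xs z∈
          (trans (sym (retract (here refl))) (trans (cong r (sym fz≡fx)) (retract (there z∈)))))

length-≤-⊆ : ∀ {A : Set} {xs ys : List A} → Unique xs → (∀ {x} → x ∈ xs → x ∈ ys) →
  length xs ≤ length ys
length-≤-⊆ !xs xs⊆ys = length-≤-by-retraction id id !xs xs⊆ys (λ _ → refl)

linked<⇒unique : ∀ {xs : List ℕ} → Linked _<_ xs → Unique xs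
linked<⇒unique = AllPairs.map <⇒≢ ∘ Linked.Linked⇒AllPairs <-trans

linked<-ext : ∀ {xs ys : List ℕ} → Linked _<_ xs → Linked _<_ ys →
  (∀ {z} → z ∈ xs → z ∈ ys) → (∀ {z} → z ∈ ys → z ∈ xs) → xs ≡ ys
linked<-ext sx sy = go (Linked.Linked⇒AllPairs <-trans sx) (Linked.Linked⇒AllPairs <-trans sy)
  where
  go : ∀ {xs ys : List ℕ} → AllPairs _<_ xs → AllPairs _<_ ys →
    (∀ {z} → z ∈ xs → z ∈ ys) → (∀ {z} → z ∈ ys → z ∈ xs) → xs ≡ ys
  go {[]} {[]} _ _ _ _ = refl
  go {[]} {y ∷ ys} _ _ _ ys⊆xs with () ← ys⊆xs (here refl)
  go {x ∷ xs} {[]} _ _ xs⊆ys _ with () ← xs⊆ys (here refl)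
  go {x ∷ xs} {y ∷ ys} (x<xs ∷ sxs) (y<ys ∷ sys) xs⊆ys ys⊆xs = cong₂ _∷_ x≡y (go sxs sys tail⊆ tail⊇)
    where
    x≡y : x ≡ y
    x≡y with xs⊆ys (here refl) | ys⊆xs (here refl)
    ... | here x≡y | _ = x≡y
    ... | there _ | here y≡x = sym y≡x
    ... | there x∈ys | there y∈xs = ⊥-elim (<-asym (All.lookup y<ys x∈ys) (All.lookup x<xs y∈xs))
    tail⊆ : ∀ {z} → z ∈ xs → z ∈ ys
    tail⊆ z∈ with xs⊆ys (there z∈)
    ... | here z≡y = ⊥-elim (<⇒≢ (All.lookup x<xs z∈) (sym (trans z≡y (sym x≡y))))
    ... | there p = p
    tail⊇ : ∀ {z} → z ∈ ys → z ∈ xs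
    tail⊇ z∈ with ys⊆xs (there z∈)
    ... | here z≡x = ⊥-elim (<⇒≢ (All.lookup y<ys z∈) (sym (trans z≡x x≡y)))
    ... | there p = p

module _ {A : Set} {f g : A → ℕ} where

  sum-map-mono : ∀ xs → (∀ {x} → x ∈ xs → f x ≤ g x) → sum (map f xs) ≤ sum (map g xs)
  sum-map-mono [] _ = z≤n
  sum-map-mono (x ∷ xs) f≤g = +-mono-≤ (f≤g (here refl)) (sum-map-mono xs (f≤g ∘ there))

  sum-map-cong : ∀ xs → (∀ {x} → x ∈ xs → f x ≡ g x) → sum (map f xs) ≡ sum (map g xs)
  sum-map-cong [] _ = refl
  sum-map-cong (x ∷ xs) f≡g = cong₂ _+_ (f≡g (here refl)) (sum-map-cong xs (f≡g ∘ there))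

sum-map-upTo-suc : ∀ (f : ℕ → ℕ) n → sum (map f (upTo (suc n))) ≡ sum (map f (upTo n)) + f n
sum-map-upTo-suc f n = begin
  sum (map f (upTo (suc n)))       ≡⟨ cong (sum ∘ map f) (upTo-∷ʳ n) ⟨
  sum (map f (upTo n ++ [ n ]))    ≡⟨ cong sum (map-++ f (upTo n) [ n ]) ⟩
  sum (map f (upTo n) ++ [ f n ])  ≡⟨ sum-++ (map f (upTo n)) [ f n ] ⟩
  sum (map f (upTo n)) + (f n + 0) ≡⟨ cong (_+_ (sum (map f (upTo n)))) (+-identityʳ (f n)) ⟩
  sum (map f (upTo n)) + f n       ∎
  where open ≡-Reasoning

module _ {A : Set} (κ : A → ℕ) where

  fibre : ℕ → List A → List A
  fibre v = filter (λ x → κ x ≟ v)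

  sum-fibre-∷ : ∀ x xs {vs} → Unique vs → κ x ∈ vs →
    sum (map (λ v → length (fibre v (x ∷ xs))) vs) ≡ suc (sum (map (λ v → length (fibre v xs)) vs))
  sum-fibre-∷ x xs {v ∷ vs} (v∉vs ∷ !vs) κx∈ with κ x ≟ v | κx∈
  ... | yes κx≡v | _ = cong₂ _+_ (cong length (filter-accept (λ y → κ y ≟ v) κx≡v))
        (sum-map-cong vs (λ v′∈ → cong length (filter-reject (λ y → κ y ≟ _)
          (λ κx≡v′ → All.lookup v∉vs v′∈ (trans (sym κx≡v) κx≡v′)))))
  ... | no κx≢v | here κx≡v = ⊥-elim (κx≢v κx≡v)
  ... | no κx≢v | there κx∈vs = trans
        (cong₂ _+_ (cong length (filter-reject (λ y → κ y ≟ v) κx≢v)) (sum-fibre-∷ x xs !vs κx∈vs))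
        (+-suc (length (fibre v xs)) _)

  length≡sum-fibres : ∀ xs {vs} → Unique vs → (∀ {x} → x ∈ xs → κ x ∈ vs) →
    length xs ≡ sum (map (λ v → length (fibre v xs)) vs)
  length≡sum-fibres [] {vs} _ _ = sym (sum-zeros vs)
    where
    sum-zeros : ∀ vs → sum (map (λ _ → 0) vs) ≡ 0
    sum-zeros [] = refl
    sum-zeros (_ ∷ vs) = sum-zeros vs
  length≡sum-fibres (x ∷ xs) !vs keys = trans
    (cong suc (length≡sum-fibres xs !vs (keys ∘ there))) (sym (sum-fibre-∷ x xs !vs (keys (here refl))))

[m+kn]%n≡m : ∀ {m} k n .{{_ : NonZero n}} → m < n → (m + k * n) % n ≡ m
[m+kn]%n≡m {m} k n m<n = trans ([m+kn]%n≡m%n m k n) (m<n⇒m%n≡m m<n)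

[m+kn]/n≡k : ∀ {m} k n .{{_ : NonZero n}} → m < n → (m + k * n) / n ≡ k
[m+kn]/n≡k {m} k n m<n = sym (*-cancelʳ-≡ k _ n (+-cancelˡ-≡ m _ _ (begin
  m + k * n                               ≡⟨ m≡m%n+[m/n]*n (m + k * n) n ⟩
  (m + k * n) % n + (m + k * n) / n * n  ≡⟨ cong (_+ (m + k * n) / n * n) ([m+kn]%n≡m k n m<n) ⟩
  m + (m + k * n) / n * n                 ∎)))
  where open ≡-Reasoning

KunzMember : ℕ → (ℕ → ℕ) → ℕ → Set
KunzMember m' k z = 0 < z % suc m' × z / suc m' < k (z % suc m')

kunzMember? : ∀ m' k → Decidable (KunzMember m' k)
kunzMember? m' k z = (0 <? z % suc m') ×-dec (z / suc m' <? k (z % suc m'))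

-- Elements are searched for below (K + 1)(m' + 1), which suffices when every k i is at most K.
fromKunz : ℕ → ℕ → (ℕ → ℕ) → List ℕ
fromKunz K m' k = filter (kunzMember? m' k) (upTo (suc K * suc m'))

KunzBounded : ℕ → ℕ → (ℕ → ℕ) → Set
KunzBounded K m' k = ∀ i → 0 < i → i < suc m' → 1 ≤ k i × k i ≤ K

KunzSubadditive : ℕ → (ℕ → ℕ) → Set
KunzSubadditive m' k = ∀ a b → 0 < a → 0 < b → a + b < suc m' → k (a + b) ≤ k a + k b

KunzWrapSubadditive : ℕ → (ℕ → ℕ) → Set
KunzWrapSubadditive m' k =
  ∀ a b e → a < suc m' → b < suc m' → 0 < e → a + b ≡ suc m' + e → k e ≤ suc (k a + k b)

module Column (m' : ℕ) {i : ℕ} (i<m : i < suc m') where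

  column : ℕ → List ℕ
  column n = map (λ q → i + q * suc m') (upTo n)

  length-column : ∀ n → length (column n) ≡ n
  length-column n = trans (length-map _ (upTo n)) (length-upTo n)

  column-unique : ∀ n → Unique (column n)
  column-unique n = Unique.map⁺ (λ e → *-cancelʳ-≡ _ _ (suc m') (+-cancelˡ-≡ i _ _ e)) (Unique.upTo⁺ n)

  ≤-kunz : ∀ {G n} → (∀ {q} → q < n → i + q * suc m' ∈ G) → n ≤ kunz G m' i
  ≤-kunz {G} {n} column⊆G = subst (_≤ kunz G m' i) (length-column n)
    (length-≤-⊆ (column-unique n) λ z∈ → case ∈-map⁻ _ z∈ of λ where
      (q , q∈ , refl) → ∈-filter⁺ (λ z → z % suc m' ≟ i) (column⊆G (∈-upTo⁻ q∈)) ([m+kn]%n≡m q (suc m') i<m))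

  kunz-≤ : ∀ {G n} → Unique G → (∀ {q} → i + q * suc m' ∈ G → q < n) → kunz G m' i ≤ n
  kunz-≤ {G} {n} !G bound = subst (kunz G m' i ≤_) (length-column n)
    (length-≤-⊆ {ys = column n} (Unique.filter⁺ (λ z → z % suc m' ≟ i) !G) λ {z} z∈ →
      case ∈-filter⁻ (λ z → z % suc m' ≟ i) {xs = G} z∈ of λ where
        (z∈G , refl) → subst (_∈ column n) (sym (m≡m%n+[m/n]*n z (suc m')))
          (∈-map⁺ (λ q → z % suc m' + q * suc m')
            (∈-upTo⁺ (bound {z / suc m'} (subst (_∈ G) (m≡m%n+[m/n]*n z (suc m')) z∈G)))))

module FromKunz (K m' : ℕ) {k : ℕ → ℕ} (bounded : KunzBounded K m' k) where

  private
    m : ℕ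
    m = suc m'

    F : List ℕ
    F = fromKunz K m' k

  ∈-fromKunz⁻ : ∀ {z} → z ∈ F → KunzMember m' k z
  ∈-fromKunz⁻ z∈ = proj₂ (∈-filter⁻ (kunzMember? m' k) {xs = upTo (suc K * m)} z∈)

  ∈-fromKunz⁺ : ∀ {z} → KunzMember m' k z → z ∈ F
  ∈-fromKunz⁺ {z} member@(r>0 , q<kr) = ∈-filter⁺ (kunzMember? m' k) (∈-upTo⁺ z<bound) member
    where
    z<bound : z < suc K * m
    z<bound = subst (_< suc K * m) (sym (m≡m%n+[m/n]*n z m))
      (+-mono-<-≤ (m%n<n z m) (*-monoˡ-≤ m (<⇒≤ (<-≤-trans q<kr (proj₂ (bounded _ r>0 (m%n<n z m)))))))

  [r+qm]∈fromKunz⁺ : ∀ {r q} → 0 < r → r < m → q < k r → r + q * m ∈ F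
  [r+qm]∈fromKunz⁺ {r} {q} r>0 r<m q<kr = ∈-fromKunz⁺
    (subst (0 <_) (sym ([m+kn]%n≡m q m r<m)) r>0 ,
     subst₂ _<_ (sym ([m+kn]/n≡k q m r<m)) (cong k (sym ([m+kn]%n≡m q m r<m))) q<kr)

  [r+qm]∈fromKunz⁻ : ∀ {r q} → r < m → r + q * m ∈ F → 0 < r × q < k r
  [r+qm]∈fromKunz⁻ {r} {q} r<m z∈ with r>0 , q<kr ← ∈-fromKunz⁻ z∈ =
    subst (0 <_) ([m+kn]%n≡m q m r<m) r>0 ,
    subst₂ _<_ ([m+kn]/n≡k q m r<m) (cong k ([m+kn]%n≡m q m r<m)) q<kr

  fromKunz-linked : Linked _<_ F
  fromKunz-linked =
    Linked.filter⁺ (kunzMember? m' k) <-trans (Linked.applyUpTo⁺₂ id (suc K * m) (λ _ → ≤-refl))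

  fromKunz-unique : Unique F
  fromKunz-unique = linked<⇒unique fromKunz-linked

  fromKunz-positive : ∀ {z} → z ∈ F → 1 ≤ z
  fromKunz-positive {zero} z∈ with () ← proj₁ (∈-fromKunz⁻ z∈)
  fromKunz-positive {suc z} _ = s≤s z≤n

  fromKunz-multiplicity : IsMultiplicity F m
  fromKunz-multiplicity = s≤s z≤n
    , (λ m∈ → <-irrefl (sym (n%n≡0 m)) (proj₁ (∈-fromKunz⁻ m∈)))
    , λ s s>0 s<m → subst (_∈ F) (+-identityʳ s) ([r+qm]∈fromKunz⁺ s>0 s<m (proj₁ (bounded s s>0 s<m)))

  kunz-fromKunz : ∀ i → 0 < i → i < m → kunz F m' i ≡ k i
  kunz-fromKunz i i>0 i<m = ≤-antisym
    (kunz-≤ fromKunz-unique (proj₂ ∘ [r+qm]∈fromKunz⁻ i<m))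
    (≤-kunz ([r+qm]∈fromKunz⁺ i>0 i<m))
    where open Column m' i<m

  ∉-fromKunz : ∀ {x} → x ∉ F → x % m ≡ 0 ⊎ (0 < x % m × k (x % m) ≤ x / m)
  ∉-fromKunz {x} x∉ with x % m ≟ 0 | x / m <? k (x % m)
  ... | yes r≡0 | _ = inj₁ r≡0
  ... | no r≢0 | yes q<kr = ⊥-elim (x∉ (∈-fromKunz⁺ (n≢0⇒n>0 r≢0 , q<kr)))
  ... | no r≢0 | no q≮kr = inj₂ (n≢0⇒n>0 r≢0 , ≮⇒≥ q≮kr)

  module _ (subadditive : KunzSubadditive m' k) (wrapSubadditive : KunzWrapSubadditive m' k) where

    multiple-+-∉ : ∀ {x y} → x % m ≡ 0 → y ∉ F → x + y ∉ F
    multiple-+-∉ {x} {y} x%m≡0 y∉ x+y∈ =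
      y∉ (∈-fromKunz⁺ (proj₁ member , ≤-<-trans (m≤m+n (y / m) (x / m)) (proj₂ member)))
      where
      shift : ∀ p m b s → (0 + p * m) + (b + s * m) ≡ b + (s + p) * m
      shift = solve-∀
      x+y≡ : x + y ≡ y % m + (y / m + x / m) * m
      x+y≡ = trans (cong₂ _+_ (trans (m≡m%n+[m/n]*n x m) (cong (_+ x / m * m) x%m≡0)) (m≡m%n+[m/n]*n y m))
                   (shift (x / m) m (y % m) (y / m))
      member : 0 < y % m × y / m + x / m < k (y % m)
      member = [r+qm]∈fromKunz⁻ (m%n<n y m) (subst (_∈ F) x+y≡ x+y∈)

    -- The sum lies at height p + s in the column of residue a + b, at height p + s + 1 in that of
    -- a + b - m, or is a multiple of m; the Kunz inequalities say these columns are not that tall.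
    above-kunz-+-∉ : ∀ {a p b s} → 0 < a → 0 < b → a < m → b < m → k a ≤ p → k b ≤ s →
      (a + b) + (p + s) * m ∉ F
    above-kunz-+-∉ {a} {p} {b} {s} a>0 b>0 a<m b<m ka≤p kb≤s z∈ with <-cmp (a + b) m
    ... | tri< a+b<m _ _ = <-irrefl refl (<-≤-trans (proj₂ ([r+qm]∈fromKunz⁻ a+b<m z∈))
          (≤-trans (subadditive a b a>0 b>0 a+b<m) (+-mono-≤ ka≤p kb≤s)))
    ... | tri≈ _ a+b≡m _ = <-irrefl refl (proj₁ ([r+qm]∈fromKunz⁻ {q = suc (p + s)} (s≤s z≤n)
          (subst (_∈ F) (cong (_+ (p + s) * m) a+b≡m) z∈)))
    ... | tri> _ _ a+b>m = <-irrefl refl (<-≤-trans (proj₂ ([r+qm]∈fromKunz⁻ e<m (subst (_∈ F) z≡′ z∈)))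
          (≤-trans (wrapSubadditive a b e a<m b<m e>0 a+b≡m+e) (s≤s (+-mono-≤ ka≤p kb≤s))))
      where
      e = a + b ∸ m
      a+b≡m+e : a + b ≡ m + e
      a+b≡m+e = sym (m+[n∸m]≡n (<⇒≤ a+b>m))
      e>0 : 0 < e
      e>0 = +-cancelˡ-< m 0 e (subst (m + 0 <_) a+b≡m+e (subst (_< a + b) (sym (+-identityʳ m)) a+b>m))
      e<m : e < m
      e<m = +-cancelˡ-< m e m (subst (_< m + m) a+b≡m+e (+-mono-< a<m b<m))
      carry : ∀ m e q → (m + e) + q * m ≡ e + suc q * m
      carry = solve-∀
      z≡′ : (a + b) + (p + s) * m ≡ e + suc (p + s) * m
      z≡′ = trans (cong (_+ (p + s) * m) a+b≡m+e) (carry m e (p + s))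

    +-∉ : ∀ {x y} → x ∉ F → y ∉ F → x + y ∉ F
    +-∉ {x} {y} x∉ y∉ with ∉-fromKunz x∉ | ∉-fromKunz y∉
    ... | inj₁ x%m≡0 | _ = multiple-+-∉ x%m≡0 y∉
    ... | inj₂ _ | inj₁ y%m≡0 = subst (_∉ F) (+-comm y x) (multiple-+-∉ y%m≡0 x∉)
    ... | inj₂ (a>0 , ka≤p) | inj₂ (b>0 , kb≤s) = subst (_∉ F) (sym x+y≡)
          (above-kunz-+-∉ a>0 b>0 (m%n<n x m) (m%n<n y m) ka≤p kb≤s)
      where
      regroup : ∀ a p b s m → (a + p * m) + (b + s * m) ≡ (a + b) + (p + s) * m
      regroup = solve-∀
      x+y≡ : x + y ≡ (x % m + y % m) + (x / m + y / m) * m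
      x+y≡ = trans (cong₂ _+_ (m≡m%n+[m/n]*n x m) (m≡m%n+[m/n]*n y m))
                   (regroup (x % m) (x / m) (y % m) (y / m) m)

    fromKunz-isGapset : IsGapset F
    fromKunz-isGapset = (fromKunz-linked , All.tabulate fromKunz-positive) , gap
      where
      gap : ∀ z x y → z ∈ F → 1 ≤ x → 1 ≤ y → z ≡ x + y → x ∈ F ⊎ y ∈ F
      gap _ x y z∈ _ _ refl with x ∈? F | y ∈? F
      ... | yes x∈ | _ = inj₁ x∈
      ... | no _ | yes y∈ = inj₂ y∈
      ... | no x∉ | no y∉ = ⊥-elim (+-∉ x∉ y∉ z∈)

module Gapset {G : List ℕ} (gapset : IsGapset G) {m' : ℕ} (mult : IsMultiplicity G (suc m')) where

  private
    m : ℕ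
    m = suc m'

    m∉G : m ∉ G
    m∉G = proj₁ (proj₂ mult)

    gap : ∀ z x y → z ∈ G → 1 ≤ x → 1 ≤ y → z ≡ x + y → x ∈ G ⊎ y ∈ G
    gap = proj₂ gapset

  unique : Unique G
  unique = linked<⇒unique (proj₁ (proj₁ gapset))

  ∈-step-down : ∀ {i q} → 1 ≤ i → i + suc q * m ∈ G → i + q * m ∈ G
  ∈-step-down {i} {q} i≥1 z∈ = [ id , ⊥-elim ∘ m∉G ]′
    (gap _ (i + q * m) m z∈ (≤-trans i≥1 (m≤m+n i (q * m))) (s≤s z≤n) (shift i q m))
    where
    shift : ∀ i q m → i + suc q * m ≡ (i + q * m) + m
    shift = solve-∀

  ∈-down : ∀ {i q q′} → 1 ≤ i → q ≤ q′ → i + q′ * m ∈ G → i + q * m ∈ G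
  ∈-down {q′ = zero} _ z≤n z∈ = z∈
  ∈-down {q = q} {q′ = suc q′} i≥1 q≤q′ z∈ with m≤n⇒m<n∨m≡n q≤q′
  ... | inj₂ refl = z∈
  ... | inj₁ q<q′ = ∈-down {q = q} {q′ = q′} i≥1 (s≤s⁻¹ q<q′) (∈-step-down {q = q′} i≥1 z∈)

  multiple-∉ : ∀ q → q * m ∉ G
  multiple-∉ zero 0∈G with () ← All.lookup (proj₂ (proj₁ gapset)) 0∈G
  multiple-∉ (suc q) z∈ = m∉G (subst (_∈ G) (+-identityʳ m) (∈-down {q = 0} {q′ = q} (s≤s z≤n) z≤n z∈))

  residue-positive : ∀ {z} → z ∈ G → 0 < z % m
  residue-positive {z} z∈ = n≢0⇒n>0 λ r≡0 →
    multiple-∉ (z / m) (subst (_∈ G) (trans (m≡m%n+[m/n]*n z m) (cong (_+ z / m * m) r≡0)) z∈)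

  ∈⇒<kunz : ∀ {i q} → 0 < i → i < m → i + q * m ∈ G → q < kunz G m' i
  ∈⇒<kunz i>0 i<m z∈ = ≤-kunz (λ q′<1+q → ∈-down i>0 (s≤s⁻¹ q′<1+q) z∈)
    where open Column m' i<m

  <kunz⇒∈ : ∀ {i q} → 0 < i → i < m → q < kunz G m' i → i + q * m ∈ G
  <kunz⇒∈ {i} {q} i>0 i<m q<k with (i + q * m) ∈? G
  ... | yes z∈ = z∈
  ... | no z∉ = ⊥-elim (<⇒≱ q<k (kunz-≤ unique (λ q′∈ → ≰⇒> (λ q≤q′ → z∉ (∈-down i>0 q≤q′ q′∈)))))
    where open Column m' i<m

  ∈⇒kunzMember : ∀ {z} → z ∈ G → KunzMember m' (kunz G m') z
  ∈⇒kunzMember {z} z∈ = r>0 , ∈⇒<kunz r>0 (m%n<n z m) (subst (_∈ G) (m≡m%n+[m/n]*n z m) z∈)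
    where r>0 = residue-positive z∈

  kunzMember⇒∈ : ∀ {z} → KunzMember m' (kunz G m') z → z ∈ G
  kunzMember⇒∈ {z} (r>0 , q<k) = subst (_∈ G) (sym (m≡m%n+[m/n]*n z m)) (<kunz⇒∈ r>0 (m%n<n z m) q<k)

  kunz-zero : kunz G m' 0 ≡ 0
  kunz-zero = cong length (filter-none (λ z → z % m ≟ 0)
    (All.tabulate (λ z∈ r≡0 → <⇒≢ (residue-positive z∈) (sym r≡0))))

  kunz-subadditive : KunzSubadditive m' (kunz G m')
  kunz-subadditive a b a>0 b>0 a+b<m = ≮⇒≥ λ ka+kb<k → case gap _ (a + ka * m) (b + kb * m)
      (<kunz⇒∈ (≤-trans a>0 (m≤m+n a b)) a+b<m ka+kb<k) (≤-trans a>0 (m≤m+n a _)) (≤-trans b>0 (m≤m+n b _))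
      (regroup a b ka kb m) of λ where
      (inj₁ x∈) → <-irrefl refl (∈⇒<kunz a>0 (≤-<-trans (m≤m+n a b) a+b<m) x∈)
      (inj₂ y∈) → <-irrefl refl (∈⇒<kunz b>0 (≤-<-trans (m≤n+m b a) a+b<m) y∈)
    where
    ka = kunz G m' a
    kb = kunz G m' b
    regroup : ∀ a b p s m → (a + b) + (p + s) * m ≡ (a + p * m) + (b + s * m)
    regroup = solve-∀

  ≡fromKunz : ∀ {K} → KunzBounded K m' (kunz G m') → G ≡ fromKunz K m' (kunz G m')
  ≡fromKunz {K} bounded = linked<-ext (proj₁ (proj₁ gapset)) fromKunz-linked
    (∈-fromKunz⁺ ∘ ∈⇒kunzMember) (kunzMember⇒∈ ∘ ∈-fromKunz⁻)
    where open FromKunz K m' bounded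

fromKunz-cong : ∀ K m' {k₁ k₂ : ℕ → ℕ} → (∀ i → 0 < i → i < suc m' → k₁ i ≡ k₂ i) →
  fromKunz K m' k₁ ≡ fromKunz K m' k₂
fromKunz-cong K m' {k₁} {k₂} k₁≡k₂ =
  filter-≐ (kunzMember? m' k₁) (kunzMember? m' k₂) ((λ {z} → to {z}) , (λ {z} → from {z}))
    (upTo (suc K * suc m'))
  where
  to : ∀ {z} → KunzMember m' k₁ z → KunzMember m' k₂ z
  to {z} (r>0 , q<k) = r>0 , subst (z / suc m' <_) (k₁≡k₂ _ r>0 (m%n<n z (suc m'))) q<k
  from : ∀ {z} → KunzMember m' k₂ z → KunzMember m' k₁ z
  from {z} (r>0 , q<k) = r>0 , subst (z / suc m' <_) (sym (k₁≡k₂ _ r>0 (m%n<n z (suc m')))) q<k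

∈⇒≤sum : ∀ {z ns} → z ∈ ns → z ≤ sum ns
∈⇒≤sum {ns = n ∷ ns} (here refl) = m≤m+n n (sum ns)
∈⇒≤sum {ns = n ∷ ns} (there z∈) = ≤-trans (∈⇒≤sum z∈) (m≤n+m (sum ns) n)

firstNonMemberFrom : List ℕ → ℕ → ℕ → ℕ
firstNonMemberFrom G s zero = s
firstNonMemberFrom G s (suc fuel) with s ∈? G
... | yes _ = firstNonMemberFrom G (suc s) fuel
... | no _ = s

-- The search cannot run out of fuel: no element of G exceeds sum G.
multiplicity : List ℕ → ℕ
multiplicity G = firstNonMemberFrom G 1 (suc (sum G))

firstNonMemberFrom-multiplicity : ∀ G s fuel → 1 ≤ s → (∀ t → 1 ≤ t → t < s → t ∈ G) → sum G < s + fuel →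
  IsMultiplicity G (firstNonMemberFrom G s fuel)
firstNonMemberFrom-multiplicity G s zero s≥1 below sum<s+0 =
  s≥1 , (λ s∈ → <⇒≱ (subst (sum G <_) (+-identityʳ s) sum<s+0) (∈⇒≤sum s∈)) , below
firstNonMemberFrom-multiplicity G s (suc fuel) s≥1 below sum< with s ∈? G
... | no s∉ = s≥1 , s∉ , below
... | yes s∈ =
  firstNonMemberFrom-multiplicity G (suc s) fuel (s≤s z≤n) below′ (subst (sum G <_) (+-suc s fuel) sum<)
  where
  below′ : ∀ t → 1 ≤ t → t < suc s → t ∈ G
  below′ t t≥1 t<1+s with m≤n⇒m<n∨m≡n (s≤s⁻¹ t<1+s)
  ... | inj₁ t<s = below t t≥1 t<s
  ... | inj₂ refl = s∈

multiplicity-correct : ∀ G → IsMultiplicity G (multiplicity G)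
multiplicity-correct G = firstNonMemberFrom-multiplicity G 1 (suc (sum G)) ≤-refl
  (λ t t≥1 t<1 → ⊥-elim (<⇒≱ t<1 t≥1)) (m≤n⇒m≤1+n (n<1+n (sum G)))

multiplicity-unique : ∀ {G m₁ m₂} → IsMultiplicity G m₁ → IsMultiplicity G m₂ → m₁ ≡ m₂
multiplicity-unique {m₁ = m₁} {m₂} (m₁≥1 , m₁∉ , below₁) (m₂≥1 , m₂∉ , below₂) with <-cmp m₁ m₂
... | tri< m₁<m₂ _ _ = ⊥-elim (m₁∉ (below₂ m₁ m₁≥1 m₁<m₂))
... | tri≈ _ m₁≡m₂ _ = m₁≡m₂
... | tri> _ _ m₁>m₂ = ⊥-elim (m₂∉ (below₁ m₂ m₂≥1 m₁>m₂))

gapset-1∈ : ∀ {G} → IsGapset G → ∀ z → suc z ∈ G → 1 ∈ G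
gapset-1∈ _ zero 1∈ = 1∈
gapset-1∈ gapset (suc z) z∈ = [ id , gapset-1∈ gapset z ]′ (proj₂ gapset _ 1 (suc z) z∈ ≤-refl (s≤s z≤n) refl)

genus≡sum-kunz : ∀ G m' → genus G ≡ sum (map (kunz G m') (upTo (suc m')))
genus≡sum-kunz G m' =
  length≡sum-fibres (_% suc m') G (Unique.upTo⁺ (suc m')) (λ {z} _ → ∈-upTo⁺ (m%n<n z (suc m')))

genus-≡-+-lastKunz : ∀ {E G m'} → IsGapset E → IsMultiplicity E (suc (suc m')) →
  IsGapset G → IsMultiplicity G (suc m') →
  (∀ i → 0 < i → i < suc m' → kunz E (suc m') i ≡ kunz G m' i) →
  genus E ≡ genus G + kunz E (suc m') (suc m')
genus-≡-+-lastKunz {E} {G} {m'} gapsetE multE gapsetG multG agree = begin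
  genus E                                                   ≡⟨ genus≡sum-kunz E (suc m') ⟩
  sum (map kE (upTo (suc (suc m'))))                        ≡⟨ sum-map-upTo-suc kE (suc m') ⟩
  sum (map kE (upTo (suc m'))) + kE (suc m')                ≡⟨ cong (_+ kE (suc m')) (sum-map-cong (upTo (suc m'))
                                                                 (λ i∈ → agree′ _ (∈-upTo⁻ i∈))) ⟩
  sum (map (kunz G m') (upTo (suc m'))) + kE (suc m')       ≡⟨ cong (_+ kE (suc m')) (genus≡sum-kunz G m') ⟨
  genus G + kE (suc m')                                     ∎
  where
  open ≡-Reasoning
  kE = kunz E (suc m')
  agree′ : ∀ i → i < suc m' → kE i ≡ kunz G m' i
  agree′ zero _ = trans (Gapset.kunz-zero gapsetE multE) (sym (Gapset.kunz-zero gapsetG multG))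
  agree′ (suc i) i<m = agree (suc i) (s≤s z≤n) i<m

KunzInInterval : ℕ → ℕ → (ℕ → ℕ) → Set
KunzInInterval ℓ m' k = ∀ i → 0 < i → i < suc m' → ℓ ≤ k i × k i ≤ 2 * ℓ + 1

interval⇒bounded : ∀ {ℓ m' k} → 1 ≤ ℓ → KunzInInterval ℓ m' k → KunzBounded (2 * ℓ + 1) m' k
interval⇒bounded ℓ≥1 interval i i>0 i<m = ≤-trans ℓ≥1 (proj₁ (interval i i>0 i<m)) , proj₂ (interval i i>0 i<m)

interval⇒wrapSubadditive : ∀ {ℓ m' k} → KunzInInterval ℓ m' k → KunzWrapSubadditive m' k
interval⇒wrapSubadditive {ℓ} {m'} {k} interval a b e a<m b<m e>0 a+b≡m+e = begin
  k e                   ≤⟨ proj₂ (interval e e>0 e<m) ⟩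
  2 * ℓ + 1             ≡⟨ double ℓ ⟩
  suc (ℓ + ℓ)           ≤⟨ s≤s (+-mono-≤ (proj₁ (interval a a>0 a<m)) (proj₁ (interval b b>0 b<m))) ⟩
  suc (k a + k b)       ∎
  where
  open ≤-Reasoning
  double : ∀ ℓ → 2 * ℓ + 1 ≡ suc (ℓ + ℓ)
  double = solve-∀
  e<m : e < suc m'
  e<m = +-cancelˡ-< (suc m') e (suc m') (subst (_< suc m' + suc m') a+b≡m+e (+-mono-< a<m b<m))
  positive : ∀ {x y} → y < suc m' → x + y ≡ suc m' + e → 0 < x
  positive {zero} y<m y≡m+e = ⊥-elim (<⇒≱ y<m (subst (suc m' ≤_) (sym y≡m+e) (m≤m+n (suc m') e)))
  positive {suc x} _ _ = s≤s z≤n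
  a>0 = positive b<m a+b≡m+e
  b>0 = positive a<m (trans (+-comm b a) a+b≡m+e)

module FromInterval {ℓ m' : ℕ} {k : ℕ → ℕ} (ℓ≥1 : 1 ≤ ℓ) (interval : KunzInInterval ℓ m' k)
                    (subadditive : KunzSubadditive m' k) where

  open FromKunz (2 * ℓ + 1) m' (interval⇒bounded ℓ≥1 interval) public
    using (fromKunz-multiplicity; kunz-fromKunz)
  open FromKunz (2 * ℓ + 1) m' (interval⇒bounded ℓ≥1 interval) using (fromKunz-isGapset)

  fromInterval-isGapset : IsGapset (fromKunz (2 * ℓ + 1) m' k)
  fromInterval-isGapset = fromKunz-isGapset subadditive (interval⇒wrapSubadditive interval)

  fromInterval-kunzInRange : KunzInRange ℓ (fromKunz (2 * ℓ + 1) m' k)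
  fromInterval-kunzInRange m″ mult i i>0 i<m
    with refl ← suc-injective (multiplicity-unique mult fromKunz-multiplicity) =
    subst (λ t → ℓ ≤ t × t ≤ 2 * ℓ + 1) (sym (kunz-fromKunz i i>0 i<m)) (interval i i>0 i<m)

extendKunz : ℕ → ℕ → (ℕ → ℕ) → ℕ → ℕ
extendKunz n c k i with i ≟ n
... | yes _ = c
... | no _ = k i

extendKunz-≡ : ∀ n c k → extendKunz n c k n ≡ c
extendKunz-≡ n c k with n ≟ n
... | yes _ = refl
... | no n≢n = ⊥-elim (n≢n refl)

extendKunz-< : ∀ {n i} c k → i < n → extendKunz n c k i ≡ k i
extendKunz-< {n} {i} c k i<n with i ≟ n
... | yes refl = ⊥-elim (<-irrefl refl i<n)
... | no _ = refl

extendKunz-interval : ∀ {ℓ m' k c} → KunzInInterval ℓ m' k → ℓ ≤ c → c ≤ 2 * ℓ + 1 →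
  KunzInInterval ℓ (suc m') (extendKunz (suc m') c k)
extendKunz-interval {ℓ} {m'} {k} {c} interval ℓ≤c c≤2ℓ+1 i i>0 i<m+1 with m<1+n⇒m<n∨m≡n i<m+1
... | inj₁ i<m = subst (λ t → ℓ ≤ t × t ≤ 2 * ℓ + 1) (sym (extendKunz-< c k i<m)) (interval i i>0 i<m)
... | inj₂ refl = subst (λ t → ℓ ≤ t × t ≤ 2 * ℓ + 1) (sym (extendKunz-≡ (suc m') c k)) (ℓ≤c , c≤2ℓ+1)

extendKunz-subadditive : ∀ {ℓ m' k c} → KunzInInterval ℓ m' k → KunzSubadditive m' k → c ≤ 2 * ℓ →
  KunzSubadditive (suc m') (extendKunz (suc m') c k)
extendKunz-subadditive {ℓ} {m'} {k} {c} interval subadditive c≤2ℓ a b a>0 b>0 a+b<m+1 =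
  case m<1+n⇒m<n∨m≡n a+b<m+1 of λ where
    (inj₁ a+b<m) → begin
      k′ (a + b)      ≡⟨ extendKunz-< c k a+b<m ⟩
      k (a + b)       ≤⟨ subadditive a b a>0 b>0 a+b<m ⟩
      k a + k b       ≡⟨ k≡k′ ⟩
      k′ a + k′ b     ∎
    (inj₂ a+b≡m) → begin
      k′ (a + b)      ≡⟨ trans (cong k′ a+b≡m) (extendKunz-≡ (suc m') c k) ⟩
      c               ≤⟨ c≤2ℓ ⟩
      ℓ + (ℓ + 0)     ≡⟨ cong (_+_ ℓ) (+-identityʳ ℓ) ⟩
      ℓ + ℓ           ≤⟨ +-mono-≤ (proj₁ (interval a a>0 a<m)) (proj₁ (interval b b>0 b<m)) ⟩
      k a + k b       ≡⟨ k≡k′ ⟩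
      k′ a + k′ b     ∎
  where
  open ≤-Reasoning
  k′ = extendKunz (suc m') c k
  a<m : a < suc m'
  a<m = <-≤-trans (m<m+n a b>0) (m<1+n⇒m≤n a+b<m+1)
  b<m : b < suc m'
  b<m = <-≤-trans (m<n+m b a>0) (m<1+n⇒m≤n a+b<m+1)
  k≡k′ : k a + k b ≡ k′ a + k′ b
  k≡k′ = sym (cong₂ _+_ (extendKunz-< c k a<m) (extendKunz-< c k b<m))

-- For G of multiplicity m, extend sets k_m := c and truncate forgets k_{m-1} = lastKunz G.
extend : ℕ → ℕ → List ℕ → List ℕ
extend ℓ c G =
  fromKunz (2 * ℓ + 1) (multiplicity G) (extendKunz (multiplicity G) c (kunz G (pred (multiplicity G))))

truncate : ℕ → List ℕ → List ℕ
truncate ℓ G = fromKunz (2 * ℓ + 1) (pred (pred (multiplicity G))) (kunz G (pred (multiplicity G)))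

lastKunz : List ℕ → ℕ
lastKunz G = kunz G (pred (multiplicity G)) (pred (multiplicity G))

module _ {G : List ℕ} {m' : ℕ} (mult : IsMultiplicity G (suc m')) where

  private
    multiplicity≡ : multiplicity G ≡ suc m'
    multiplicity≡ = multiplicity-unique (multiplicity-correct G) mult

  extend-≡ : ∀ ℓ c → extend ℓ c G ≡ fromKunz (2 * ℓ + 1) (suc m') (extendKunz (suc m') c (kunz G m'))
  extend-≡ ℓ c = cong (λ m → fromKunz (2 * ℓ + 1) m (extendKunz m c (kunz G (pred m)))) multiplicity≡

  truncate-≡ : ∀ ℓ → truncate ℓ G ≡ fromKunz (2 * ℓ + 1) (pred m') (kunz G m')
  truncate-≡ ℓ = cong (λ m → fromKunz (2 * ℓ + 1) (pred (pred m)) (kunz G (pred m))) multiplicity≡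

  lastKunz-≡ : lastKunz G ≡ kunz G m' m'
  lastKunz-≡ = cong (λ m → kunz G (pred m) (pred m)) multiplicity≡

module Extension {ℓ : ℕ} (ℓ≥1 : 1 ≤ ℓ) {G : List ℕ} (gapset : IsGapset G) (inRange : KunzInRange ℓ G)
                 {m' : ℕ} (mult : IsMultiplicity G (suc m')) {c : ℕ} (ℓ≤c : ℓ ≤ c) (c≤2ℓ : c ≤ 2 * ℓ) where

  private
    k′ : ℕ → ℕ
    k′ = extendKunz (suc m') c (kunz G m')

    E : List ℕ
    E = fromKunz (2 * ℓ + 1) (suc m') k′

    open FromInterval ℓ≥1 (extendKunz-interval (inRange m' mult) ℓ≤c (≤-trans c≤2ℓ (m≤m+n (2 * ℓ) 1)))
      (extendKunz-subadditive (inRange m' mult) (Gapset.kunz-subadditive gapset mult) c≤2ℓ)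

    kunzE-< : ∀ i → 0 < i → i < suc m' → kunz E (suc m') i ≡ kunz G m' i
    kunzE-< i i>0 i<m = trans (kunz-fromKunz i i>0 (m≤n⇒m≤1+n i<m)) (extendKunz-< c (kunz G m') i<m)

    kunzE-last : kunz E (suc m') (suc m') ≡ c
    kunzE-last = trans (kunz-fromKunz (suc m') (s≤s z≤n) ≤-refl) (extendKunz-≡ (suc m') c (kunz G m'))

  extend-isGapset : IsGapset (extend ℓ c G)
  extend-isGapset = subst IsGapset (sym (extend-≡ mult ℓ c)) fromInterval-isGapset

  extend-kunzInRange : KunzInRange ℓ (extend ℓ c G)
  extend-kunzInRange = subst (KunzInRange ℓ) (sym (extend-≡ mult ℓ c)) fromInterval-kunzInRange

  genus-extend : genus (extend ℓ c G) ≡ genus G + c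
  genus-extend = begin
    genus (extend ℓ c G)                  ≡⟨ cong genus (extend-≡ mult ℓ c) ⟩
    genus E                               ≡⟨ genus-≡-+-lastKunz fromInterval-isGapset fromKunz-multiplicity
                                               gapset mult kunzE-< ⟩
    genus G + kunz E (suc m') (suc m')    ≡⟨ cong (_+_ (genus G)) kunzE-last ⟩
    genus G + c                           ∎
    where open ≡-Reasoning

  lastKunz-extend : lastKunz (extend ℓ c G) ≡ c
  lastKunz-extend =
    trans (cong lastKunz (extend-≡ mult ℓ c)) (trans (lastKunz-≡ fromKunz-multiplicity) kunzE-last)

  truncate-extend : truncate ℓ (extend ℓ c G) ≡ G
  truncate-extend = begin
    truncate ℓ (extend ℓ c G)                  ≡⟨ cong (truncate ℓ) (extend-≡ mult ℓ c) ⟩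
    truncate ℓ E                               ≡⟨ truncate-≡ fromKunz-multiplicity ℓ ⟩
    fromKunz (2 * ℓ + 1) m' (kunz E (suc m'))  ≡⟨ fromKunz-cong (2 * ℓ + 1) m' kunzE-< ⟩
    fromKunz (2 * ℓ + 1) m' (kunz G m')        ≡⟨ Gapset.≡fromKunz gapset mult
                                                    (interval⇒bounded ℓ≥1 (inRange m' mult)) ⟨
    G                                          ∎
    where open ≡-Reasoning

module Truncation {ℓ : ℕ} (ℓ≥1 : 1 ≤ ℓ) {G : List ℕ} (gapset : IsGapset G) (inRange : KunzInRange ℓ G)
                  {p : ℕ} (mult : IsMultiplicity G (suc (suc p))) where

  private
    k : ℕ → ℕ
    k = kunz G (suc p)

    T : List ℕ
    T = fromKunz (2 * ℓ + 1) p k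

    open FromInterval ℓ≥1 (λ i i>0 i<m → inRange (suc p) mult i i>0 (m≤n⇒m≤1+n i<m))
      (λ a b a>0 b>0 a+b<m → Gapset.kunz-subadditive gapset mult a b a>0 b>0 (m≤n⇒m≤1+n a+b<m))

  lastKunz-interval : ℓ ≤ lastKunz G × lastKunz G ≤ 2 * ℓ + 1
  lastKunz-interval = subst (λ t → ℓ ≤ t × t ≤ 2 * ℓ + 1) (sym (lastKunz-≡ mult))
    (inRange (suc p) mult (suc p) (s≤s z≤n) ≤-refl)

  truncate-isGapset : IsGapset (truncate ℓ G)
  truncate-isGapset = subst IsGapset (sym (truncate-≡ mult ℓ)) fromInterval-isGapset

  truncate-kunzInRange : KunzInRange ℓ (truncate ℓ G)
  truncate-kunzInRange = subst (KunzInRange ℓ) (sym (truncate-≡ mult ℓ)) fromInterval-kunzInRange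

  genus-truncate : genus (truncate ℓ G) + lastKunz G ≡ genus G
  genus-truncate = sym (begin
    genus G                          ≡⟨ genus-≡-+-lastKunz gapset mult fromInterval-isGapset fromKunz-multiplicity
                                          (λ i i>0 i<m → sym (kunz-fromKunz i i>0 i<m)) ⟩
    genus T + k (suc p)              ≡⟨ cong₂ _+_ (cong genus (truncate-≡ mult ℓ)) (lastKunz-≡ mult) ⟨
    genus (truncate ℓ G) + lastKunz G ∎)
    where open ≡-Reasoning

  extend-truncate : extend ℓ (lastKunz G) (truncate ℓ G) ≡ G
  extend-truncate = begin
    extend ℓ (lastKunz G) (truncate ℓ G)
      ≡⟨ cong₂ (extend ℓ) (lastKunz-≡ mult) (truncate-≡ mult ℓ) ⟩
    extend ℓ (k (suc p)) T
      ≡⟨ extend-≡ fromKunz-multiplicity ℓ (k (suc p)) ⟩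
    fromKunz (2 * ℓ + 1) (suc p) (extendKunz (suc p) (k (suc p)) (kunz T p))
      ≡⟨ fromKunz-cong (2 * ℓ + 1) (suc p) agree ⟩
    fromKunz (2 * ℓ + 1) (suc p) k
      ≡⟨ Gapset.≡fromKunz gapset mult (interval⇒bounded ℓ≥1 (inRange (suc p) mult)) ⟨
    G ∎
    where
    open ≡-Reasoning
    agree : ∀ i → 0 < i → i < suc (suc p) → extendKunz (suc p) (k (suc p)) (kunz T p) i ≡ k i
    agree i i>0 i<m with m<1+n⇒m<n∨m≡n i<m
    ... | inj₁ i<m′ = trans (extendKunz-< (k (suc p)) (kunz T p) i<m′) (kunz-fromKunz i i>0 i<m′)
    ... | inj₂ refl = extendKunz-≡ (suc p) (k (suc p)) (kunz T p)

∃multiplicity : ∀ G → Σ ℕ λ m' → IsMultiplicity G (suc m')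
∃multiplicity G with multiplicity G | multiplicity-correct G
... | suc m' | mult = m' , mult
... | zero | () , _

∃multiplicity≥2 : ∀ {G} → IsGapset G → 1 ≤ genus G → Σ ℕ λ p → IsMultiplicity G (suc (suc p))
∃multiplicity≥2 {x ∷ G} gapset _ with ∃multiplicity (x ∷ G) | All.lookup (proj₂ (proj₁ gapset)) (here refl)
... | suc p , mult | _ = p , mult
... | zero , (_ , 1∉G , _) | s≤s _ = ⊥-elim (1∉G (gapset-1∈ gapset _ (here refl)))

+a≡+g-+c⇒a+c≡g : ∀ {a c g} → + a ≡ + g - + c → a + c ≡ g
+a≡+g-+c⇒a+c≡g {c = c} {g} +a≡ = ℤ.+-injective (trans (cong (ℤ._+ + c) +a≡) (//-rightDividesˡ (+ c) (+ g)))

a+c≡g⇒+a≡+g-+c : ∀ {a c g} → a + c ≡ g → + a ≡ + g - + c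
a+c≡g⇒+a≡+g-+c {a} {c} refl = sym (//-rightDividesʳ (+ c) (+ a))

∈-map-+-upTo : ∀ {a n c} → a ≤ c → c < a + n → c ∈ map (_+_ a) (upTo n)
∈-map-+-upTo {a} {n} {c} a≤c c<a+n = subst (_∈ map (_+_ a) (upTo n)) (m+[n∸m]≡n a≤c)
  (∈-map⁺ (_+_ a) (∈-upTo⁺ (+-cancelˡ-< a _ _ (subst (_< a + n) (sym (m+[n∸m]≡n a≤c)) c<a+n))))

module Counting {ℓ g : ℕ} (ℓ≥1 : 1 ≤ ℓ) (g≥1 : 1 ≤ g) (n' : ℤ → ℕ) (count : ∀ h → IsCount ℓ h (n' h)) where

  private
    gapsets : ℤ → List (List ℕ)
    gapsets h = proj₁ (count h)

    gapsets-unique : ∀ h → Unique (gapsets h)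
    gapsets-unique h = proj₁ (proj₂ (count h))

    length-gapsets : ∀ h → length (gapsets h) ≡ n' h
    length-gapsets h = proj₂ (proj₂ (proj₂ (count h)))

    counted : ∀ {h G} → G ∈ gapsets h → Counted ℓ h G
    counted {h} {G} = Equivalence.to (proj₁ (proj₂ (proj₂ (count h))) G)

    listed : ∀ {h G} → Counted ℓ h G → G ∈ gapsets h
    listed {h} {G} = Equivalence.from (proj₁ (proj₂ (proj₂ (count h))) G)

    module _ {h G} (G∈ : G ∈ gapsets h) where

      isGapset-∈ : IsGapset G
      isGapset-∈ = proj₁ (counted G∈)

      genus-∈ : + genus G ≡ h
      genus-∈ = proj₁ (proj₂ (counted G∈))

      kunzInRange-∈ : KunzInRange ℓ G
      kunzInRange-∈ = proj₂ (proj₂ (counted G∈))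

  withLastKunz : ℕ → List (List ℕ)
  withLastKunz c = fibre lastKunz c (gapsets (+ g))

  private
    withLastKunz⁻ : ∀ {c G} → G ∈ withLastKunz c → G ∈ gapsets (+ g) × lastKunz G ≡ c
    withLastKunz⁻ {c} = ∈-filter⁻ (λ G → lastKunz G ≟ c) {xs = gapsets (+ g)}

  n'-≤-withLastKunz : ∀ {c} → ℓ ≤ c → c ≤ 2 * ℓ → n' (+ g - + c) ≤ length (withLastKunz c)
  n'-≤-withLastKunz {c} ℓ≤c c≤2ℓ = subst (_≤ length (withLastKunz c)) (length-gapsets _)
    (length-≤-by-retraction (extend ℓ c) (truncate ℓ) (gapsets-unique _) extend∈ E.truncate-extend)
    where
    module E {G} (G∈ : G ∈ gapsets (+ g - + c)) =
      Extension ℓ≥1 (isGapset-∈ G∈) (kunzInRange-∈ G∈) (proj₂ (∃multiplicity G)) ℓ≤c c≤2ℓ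
    extend∈ : ∀ {G} → G ∈ gapsets (+ g - + c) → extend ℓ c G ∈ withLastKunz c
    extend∈ G∈ = ∈-filter⁺ (λ G → lastKunz G ≟ c)
      (listed (E.extend-isGapset G∈
              , cong +_ (trans (E.genus-extend G∈) (+a≡+g-+c⇒a+c≡g (genus-∈ G∈)))
              , E.extend-kunzInRange G∈))
      (E.lastKunz-extend G∈)

  private
    module T {G} (G∈ : G ∈ gapsets (+ g)) =
      Truncation ℓ≥1 (isGapset-∈ G∈) (kunzInRange-∈ G∈)
        (proj₂ (∃multiplicity≥2 (isGapset-∈ G∈) (subst (1 ≤_) (sym (ℤ.+-injective (genus-∈ G∈))) g≥1)))

  withLastKunz-≤-n' : ∀ c → length (withLastKunz c) ≤ n' (+ g - + c)
  withLastKunz-≤-n' c = subst (length (withLastKunz c) ≤_) (length-gapsets _)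
    (length-≤-by-retraction (truncate ℓ) (extend ℓ c)
      (Unique.filter⁺ (λ G → lastKunz G ≟ c) (gapsets-unique _)) truncate∈ extend-truncate′)
    where
    truncate∈ : ∀ {G} → G ∈ withLastKunz c → truncate ℓ G ∈ gapsets (+ g - + c)
    truncate∈ G∈ = listed (T.truncate-isGapset G∈′
      , a+c≡g⇒+a≡+g-+c (trans (cong (_+_ _) (sym last≡c))
          (trans (T.genus-truncate G∈′) (ℤ.+-injective (genus-∈ G∈′))))
      , T.truncate-kunzInRange G∈′)
      where
      G∈′ = proj₁ (withLastKunz⁻ G∈)
      last≡c = proj₂ (withLastKunz⁻ G∈)
    extend-truncate′ : ∀ {G} → G ∈ withLastKunz c → extend ℓ c (truncate ℓ G) ≡ G
    extend-truncate′ {G} G∈ = subst (λ c → extend ℓ c (truncate ℓ G) ≡ G) (proj₂ (withLastKunz⁻ G∈))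
      (T.extend-truncate (proj₁ (withLastKunz⁻ G∈)))

  n'≡sum-withLastKunz : n' (+ g) ≡ sum (map (λ j → length (withLastKunz (ℓ + j))) (upTo (ℓ + 2)))
  n'≡sum-withLastKunz = begin
    n' (+ g)                                                                ≡⟨ length-gapsets (+ g) ⟨
    length (gapsets (+ g))                                                  ≡⟨ length≡sum-fibres lastKunz _
                                                                                 keys-unique lastKunz∈ ⟩
    sum (map (λ c → length (withLastKunz c)) (map (_+_ ℓ) (upTo (ℓ + 2))))  ≡⟨ cong sum (map-∘ (upTo (ℓ + 2))) ⟨
    sum (map (λ j → length (withLastKunz (ℓ + j))) (upTo (ℓ + 2)))          ∎
    where
    open ≡-Reasoning
    keys-unique : Unique (map (_+_ ℓ) (upTo (ℓ + 2)))
    keys-unique = Unique.map⁺ (+-cancelˡ-≡ ℓ _ _) (Unique.upTo⁺ (ℓ + 2))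
    suc[2ℓ+1]≡ℓ+[ℓ+2] : ∀ ℓ → suc (2 * ℓ + 1) ≡ ℓ + (ℓ + 2)
    suc[2ℓ+1]≡ℓ+[ℓ+2] = solve-∀
    lastKunz∈ : ∀ {G} → G ∈ gapsets (+ g) → lastKunz G ∈ map (_+_ ℓ) (upTo (ℓ + 2))
    lastKunz∈ {G} G∈ = ∈-map-+-upTo (proj₁ (T.lastKunz-interval G∈))
      (subst (lastKunz G <_) (suc[2ℓ+1]≡ℓ+[ℓ+2] ℓ) (s≤s (proj₂ (T.lastKunz-interval G∈))))

theorem7 : (g ℓ : ℕ) → 1 ≤ g → 1 ≤ ℓ →
    (n' : ℤ → ℕ) → (∀ h → IsCount ℓ h (n' h)) →
    sumFrom ℓ (ℓ + 1) (λ i → n' (+ g - + i)) ≤ n' (+ g)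
    × n' (+ g) ≤ sumFrom ℓ (ℓ + 2) (λ i → n' (+ g - + i))
theorem7 g ℓ g≥1 ℓ≥1 n' count = lower , upper
  where
  open Counting ℓ≥1 g≥1 n' count
  open ≤-Reasoning
  N : ℕ → ℕ
  N j = length (withLastKunz (ℓ + j))
  lower = begin
    sumFrom ℓ (ℓ + 1) (λ i → n' (+ g - + i))  ≤⟨ sum-map-mono (upTo (ℓ + 1))
                                                  (λ j∈ → n'-≤-withLastKunz (m≤m+n ℓ _) (ℓ+j≤2ℓ (∈-upTo⁻ j∈))) ⟩
    sum (map N (upTo (ℓ + 1)))                 ≤⟨ m≤m+n _ (N (ℓ + 1)) ⟩
    sum (map N (upTo (ℓ + 1))) + N (ℓ + 1)     ≡⟨ sum-map-upTo-suc N (ℓ + 1) ⟨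
    sum (map N (upTo (suc (ℓ + 1))))           ≡⟨ cong (λ n → sum (map N (upTo n))) (+-suc ℓ 1) ⟨
    sum (map N (upTo (ℓ + 2)))                 ≡⟨ n'≡sum-withLastKunz ⟨
    n' (+ g)                                   ∎
    where
    ℓ+j≤2ℓ : ∀ {j} → j < ℓ + 1 → ℓ + j ≤ 2 * ℓ
    ℓ+j≤2ℓ {j} j<ℓ+1 =
      +-monoʳ-≤ ℓ (subst (j ≤_) (sym (+-identityʳ ℓ)) (m<1+n⇒m≤n (subst (j <_) (+-comm ℓ 1) j<ℓ+1)))
  upper = begin
    n' (+ g)                                   ≡⟨ n'≡sum-withLastKunz ⟩
    sum (map N (upTo (ℓ + 2)))                 ≤⟨ sum-map-mono (upTo (ℓ + 2)) (λ _ → withLastKunz-≤-n' _) ⟩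
    sumFrom ℓ (ℓ + 2) (λ i → n' (+ g - + i))   ∎
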